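{- Let $T$ be a tree containing a path $v_1v_2x$ with $d_T(v_2)=2$ and $v_1$ a leaf of $T$. Let $T'$ be the tree obtained from $T$ by deleting the edge $v_1v_2$ and adding the edge $v_1x$. Then $\Psi(T')\geq\Psi(T)$.
   Context: A matching of a graph is a set of edges no two of which share a vertex; it is maximal if it is not properly contained in another matching. $\Psi(G)$ denotes the number of maximal matchings of $G$. A leaf is a vertex of degree $1$. -}

module Defs where

open import Data.Nat using (ℕ; zero; suc; _<_; _<ᵇ_)
open import Data.Bool using (Bool; true; false; _∧_; _∨_; not; if_then_else_)
open import Data.Fin using (Fin; toℕ)
open import Data.Fin.Properties using (_≟_)
open import Data.List using (List; []; _∷_; length; filter; map; concatMap; allFin; all; any; _++_)
open import Data.List.Relation.Unary.Unique.Propositional using (Unique)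
open import Data.List.Relation.Unary.Linked using (Linked)
open import Data.Product using (_×_; _,_; Σ; ∃; proj₁; proj₂)
open import Data.Maybe using (just)
open import Relation.Nullary.Decidable using (⌊_⌋)
open import Relation.Binary.PropositionalEquality using (_≡_)

record Graph (n : ℕ) : Set where
  field
    adj   : Fin n → Fin n → Bool
    sym   : ∀ u v → adj u v ≡ adj v u
    irrefl : ∀ v → adj v v ≡ false
open Graph public

_==_ : ∀ {n} → Fin n → Fin n → Bool
u == v = ⌊ u ≟ v ⌋

Adj : ∀ {n} → Graph n → Fin n → Fin n → Set
Adj G u v = adj G u v ≡ true

deg : ∀ {n} → Graph n → Fin n → ℕ
deg {n} G v = length (filter (λ u → adj G v u Data.Bool.≟ true) (allFin n))

Leaf : ∀ {n} → Graph n → Fin n → Set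
Leaf G v = deg G v ≡ 1

Walk : ∀ {n} → Graph n → List (Fin n) → Set
Walk G = Linked (Adj G)

head? : ∀ {n} → List (Fin n) → Fin n → Set
head? [] _ = Data.Empty.⊥ where import Data.Empty
head? (x ∷ _) v = x ≡ v

last? : ∀ {n} → List (Fin n) → Fin n → Set
last? [] _ = Data.Empty.⊥ where import Data.Empty
last? (x ∷ []) v = x ≡ v
last? (_ ∷ y ∷ ys) v = last? (y ∷ ys) v

Connected : ∀ {n} → Graph n → Set
Connected {n} G = ∀ (u v : Fin n) → Σ (List (Fin n)) λ w → Walk G w × head? w u × last? w v

IsCycle : ∀ {n} → Graph n → List (Fin n) → Set
IsCycle G [] = Data.Empty.⊥ where import Data.Empty
IsCycle G (a ∷ rest) =
  2 Data.Nat.≤ length rest × Unique (a ∷ rest) × Walk G (a ∷ rest) ×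
  ∃ λ z → last? (a ∷ rest) z × Adj G z a

Acyclic : ∀ {n} → Graph n → Set
Acyclic {n} G = ∀ (c : List (Fin n)) → IsCycle G c → Data.Empty.⊥ where import Data.Empty

IsTree : ∀ {n} → Graph n → Set
IsTree G = Connected G × Acyclic G

Edge : ℕ → Set
Edge n = Fin n × Fin n

-- the edge set, each edge {i,j} listed once as (i , j) with i < j
edges : ∀ {n} → Graph n → List (Edge n)
edges {n} G =
  concatMap (λ i → map (λ j → (i , j))
              (filter (λ j → Data.Bool._≟_ ((toℕ i <ᵇ toℕ j) ∧ adj G i j) true) (allFin n)))
            (allFin n)

subsets : ∀ {A : Set} → List A → List (List A)
subsets [] = [] ∷ []
subsets (x ∷ xs) = let s = subsets xs in s ++ map (x ∷_) s

eqE : ∀ {n} → Edge n → Edge n → Bool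
eqE (a , b) (c , d) = (a == c) ∧ (b == d)

memE : ∀ {n} → Edge n → List (Edge n) → Bool
memE e M = any (eqE e) M

subE : ∀ {n} → List (Edge n) → List (Edge n) → Bool
subE M N = all (λ e → memE e N) M

meet : ∀ {n} → Edge n → Edge n → Bool
meet (a , b) (c , d) = (a == c) ∨ (a == d) ∨ (b == c) ∨ (b == d)

isMatching : ∀ {n} → List (Edge n) → Bool
isMatching M = all (λ e → all (λ f → eqE e f ∨ not (meet e f)) M) M

isMaximalMatching : ∀ {n} → Graph n → List (Edge n) → Bool
isMaximalMatching G M =
  isMatching M ∧
  all (λ M' → not (isMatching M' ∧ subE M M' ∧ not (subE M' M))) (subsets (edges G))

Ψ : ∀ {n} → Graph n → ℕ
Ψ G = length (filter (λ M → Data.Bool._≟_ (isMaximalMatching G M) true) (subsets (edges G)))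

isPair : ∀ {n} → Fin n → Fin n → Fin n → Fin n → Bool
isPair a b u v = ((u == a) ∧ (v == b)) ∨ ((u == b) ∧ (v == a))

moveAdj : ∀ {n} → Graph n → Fin n → Fin n → Fin n → Fin n → Fin n → Bool
moveAdj G v₁ v₂ x u v =
  if isPair v₁ v₂ u v then false
  else (if isPair v₁ x u v then true else adj G u v)

-- Send a maximal matching M of T to the matching of T′ obtained by deleting v₁v₂ and, when x
-- is left unmatched, adding v₁x. The image is maximal: an edge of T′ not dominated by M − v₁v₂
-- is v₁x or v₂x, and x is always matched in the image. The map is injective because M can be
-- read off its image: every edge other than v₁v₂ keeps its status, and as v₁ is a leaf and v₂
-- has degree 2, maximality of M forces v₁v₂ ∈ M exactly when v₂x ∉ M.

module Submission where

open import Defs hiding (sym)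
open import Data.Bool using (Bool; true; false; T; not; _∧_; _∨_)
import Data.Bool as Bool
open import Data.Bool.Properties using (T-∧; T-∨; T-≡)
open import Data.Empty using (⊥; ⊥-elim)
open import Data.Fin using (Fin; toℕ)
open import Data.Fin.Properties using (_≟_; toℕ-injective)
open import Data.List using (List; []; _∷_; _++_; length; map; filter; concatMap; allFin)
open import Data.List.Membership.Propositional using (_∈_; _∉_; find; lose)
open import Data.List.Membership.Propositional.Properties
  using (∈-++⁺ˡ; ∈-++⁺ʳ; ∈-++⁻; ∈-map⁺; ∈-map⁻; ∈-∃++; ∈-filter⁺; ∈-filter⁻;
         ∈-concatMap⁺; ∈-concatMap⁻; ∈-allFin)
open import Data.List.Relation.Binary.Subset.Propositional using (_⊆_)
open import Data.List.Relation.Unary.All using (All; []; _∷_; lookup; tabulate)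
open import Data.List.Relation.Unary.All.Properties using (All¬⇒¬Any; ¬Any⇒All¬)
  renaming (all⁺ to T-all⇒All; all⁻ to All⇒T-all)
open import Data.List.Relation.Unary.AllPairs using ([]; _∷_)
open import Data.List.Relation.Unary.Any using (Any; here; there; any?)
import Data.List.Relation.Unary.Any as Any
open import Data.List.Relation.Unary.Any.Properties using ()
  renaming (any⁺ to Any⇒T-any; any⁻ to T-any⇒Any)
open import Data.List.Relation.Unary.Unique.Propositional using (Unique)
import Data.List.Relation.Unary.Unique.Propositional.Properties as Unique
open import Data.Nat using (ℕ; suc; _≤_; _<_; _≥_; s≤s; z≤n; _<ᵇ_)
open import Data.Nat.Properties using (<-cmp; <-asym; <ᵇ⇒<; <⇒<ᵇ; ≤-trans; ≤-reflexive; <-irrefl)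
open import Data.Product using (_×_; _,_; proj₁; proj₂; ∃-syntax)
open import Data.Product.Properties using (≡-dec)
open import Data.Sum using (_⊎_; inj₁; inj₂)
open import Function.Bundles using (Equivalence)
open import Level using (0ℓ)
open import Relation.Binary using (DecidableEquality; tri<; tri≈; tri>)
open import Relation.Binary.PropositionalEquality
  using (_≡_; _≢_; refl; sym; trans; cong; cong₂; subst)
open import Relation.Nullary using (¬_; Dec; yes; no)
open import Relation.Nullary.Decidable
  using (toWitness; fromWitness; _⊎-dec_; _×-dec_; ¬?; T?; map′)
open import Relation.Unary using (Pred; Decidable)

-- Sub-lists and counting by injections

module _ {A : Set} where

  subsets-⊆ : ∀ (E : List A) {M} → M ∈ subsets E → M ⊆ E
  subsets-⊆ [] (here refl) ()
  subsets-⊆ (x ∷ xs) M∈ e∈M with ∈-++⁻ (subsets xs) M∈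
  ... | inj₁ M∈′ = there (subsets-⊆ xs M∈′ e∈M)
  ... | inj₂ M∈′ with ∈-map⁻ (x ∷_) M∈′
  ...   | M′ , M′∈ , refl with e∈M
  ...     | here e≡x = here e≡x
  ...     | there e∈M′ = there (subsets-⊆ xs M′∈ e∈M′)

  filter-∈-subsets : ∀ {P : Pred A 0ℓ} (P? : Decidable P) (E : List A) → filter P? E ∈ subsets E
  filter-∈-subsets P? [] = here refl
  filter-∈-subsets P? (x ∷ xs) with P? x
  ... | yes _ = ∈-++⁺ʳ (subsets xs) (∈-map⁺ (x ∷_) (filter-∈-subsets P? xs))
  ... | no _ = ∈-++⁺ˡ (filter-∈-subsets P? xs)

  private
    head∉subsets : ∀ {x : A} {xs M} → x ∉ xs → M ∈ subsets xs → x ∉ M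
    head∉subsets x∉xs M∈ x∈M = x∉xs (subsets-⊆ _ M∈ x∈M)

  subsets-unique : ∀ {E : List A} → Unique E → Unique (subsets E)
  subsets-unique {[]} _ = [] ∷ []
  subsets-unique {x ∷ xs} (x∉xs ∷ xs!) =
    Unique.++⁺ (subsets-unique xs!) (Unique.map⁺ (λ { refl → refl }) (subsets-unique xs!)) disjoint
    where
    disjoint : ∀ {M} → M ∈ subsets xs × M ∈ map (x ∷_) (subsets xs) → ⊥
    disjoint (M∈ , xM∈) with ∈-map⁻ (x ∷_) xM∈
    ... | _ , _ , refl = head∉subsets (All¬⇒¬Any x∉xs) M∈ (here refl)

  subsets-≡ : ∀ {E : List A} → Unique E → ∀ {M N} → M ∈ subsets E → N ∈ subsets E
            → M ⊆ N → N ⊆ M → M ≡ N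
  subsets-≡ {[]} _ (here refl) (here refl) _ _ = refl
  subsets-≡ {x ∷ xs} (x∉xs ∷ xs!) M∈ N∈ M⊆N N⊆M
    with ∈-++⁻ (subsets xs) M∈ | ∈-++⁻ (subsets xs) N∈
  ... | inj₁ M∈′ | inj₁ N∈′ = subsets-≡ xs! M∈′ N∈′ M⊆N N⊆M
  ... | inj₁ M∈′ | inj₂ xN∈ with ∈-map⁻ (x ∷_) xN∈
  ...   | _ , _ , refl = ⊥-elim (head∉subsets (All¬⇒¬Any x∉xs) M∈′ (N⊆M (here refl)))
  subsets-≡ {x ∷ xs} (x∉xs ∷ xs!) M∈ N∈ M⊆N N⊆M | inj₂ xM∈ | inj₁ N∈′ with ∈-map⁻ (x ∷_) xM∈
  ...   | _ , _ , refl = ⊥-elim (head∉subsets (All¬⇒¬Any x∉xs) N∈′ (M⊆N (here refl)))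
  subsets-≡ {x ∷ xs} (x∉xs ∷ xs!) M∈ N∈ M⊆N N⊆M | inj₂ xM∈ | inj₂ xN∈
    with ∈-map⁻ (x ∷_) xM∈ | ∈-map⁻ (x ∷_) xN∈
  ... | M′ , M′∈ , refl | N′ , N′∈ , refl =
    cong (x ∷_) (subsets-≡ xs! M′∈ N′∈ (tail-⊆ M′∈ M⊆N) (tail-⊆ N′∈ N⊆M))
    where
    tail-⊆ : ∀ {K L} → K ∈ subsets xs → x ∷ K ⊆ x ∷ L → K ⊆ L
    tail-⊆ K∈ xK⊆xL e∈K with xK⊆xL (there e∈K)
    ... | here refl = ⊥-elim (head∉subsets (All¬⇒¬Any x∉xs) K∈ e∈K)
    ... | there e∈L = e∈L

length-≤-injection : ∀ {A B : Set} (f : A → B) {xs : List A} {ys : List B} → Unique xs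
  → (∀ {a} → a ∈ xs → f a ∈ ys)
  → (∀ {a b} → a ∈ xs → b ∈ xs → f a ≡ f b → a ≡ b)
  → length xs ≤ length ys
length-≤-injection f {[]} _ _ _ = z≤n
length-≤-injection f {a ∷ as} (a∉as ∷ as!) f∈ f-inj with ∈-∃++ (f∈ (here refl))
... | ys₁ , ys₂ , refl =
  subst (suc (length as) ≤_) (sym (length-middle ys₁))
    (s≤s (length-≤-injection f as! f∈′ (λ a∈ b∈ → f-inj (there a∈) (there b∈))))
  where
  length-middle : ∀ ys → length (ys ++ f a ∷ ys₂) ≡ suc (length (ys ++ ys₂))
  length-middle [] = refl
  length-middle (_ ∷ ys) = cong suc (length-middle ys)
  f∈′ : ∀ {b} → b ∈ as → f b ∈ ys₁ ++ ys₂
  f∈′ {b} b∈ with ∈-++⁻ ys₁ (f∈ (there b∈))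
  ... | inj₁ p = ∈-++⁺ˡ p
  ... | inj₂ (there p) = ∈-++⁺ʳ ys₁ p
  ... | inj₂ (here fb≡fa) =
    ⊥-elim (All¬⇒¬Any a∉as (subst (_∈ as) (f-inj (there b∈) (here refl) fb≡fa) b∈))

private variable
  n : ℕ
  G : Graph n
  p q u v : Fin n
  e f : Edge n
  M N : List (Edge n)

T-∨-introˡ : ∀ {x y} → T x → T (x ∨ y)
T-∨-introˡ t = Equivalence.from T-∨ (inj₁ t)

T-∨-introʳ : ∀ {x y} → T y → T (x ∨ y)
T-∨-introʳ {x} t = Equivalence.from (T-∨ {x}) (inj₂ t)

T-∧-intro : ∀ {x y} → T x → T y → T (x ∧ y)
T-∧-intro s t = Equivalence.from T-∧ (s , t)

T-not⇒¬T : ∀ {x} → T (not x) → ¬ T x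
T-not⇒¬T {false} _ ()

¬T⇒T-not : ∀ {x} → ¬ T x → T (not x)
¬T⇒T-not {false} _ = _
¬T⇒T-not {true} ¬t = ¬t _

-- Edges and incidence

_≟ₑ_ : DecidableEquality (Edge n)
_≟ₑ_ = ≡-dec _≟_ _≟_

Incident : Fin n → Edge n → Set
Incident v (a , b) = a ≡ v ⊎ b ≡ v

Incident? : (v : Fin n) → Decidable (Incident v)
Incident? v (a , b) = (a ≟ v) ⊎-dec (b ≟ v)

Meets : Edge n → Edge n → Set
Meets e f = ∃[ v ] Incident v e × Incident v f

Meets-sym : Meets e f → Meets f e
Meets-sym (v , ve , vf) = v , vf , ve

Meets-refl : (e : Edge n) → Meets e e
Meets-refl (a , b) = a , inj₁ refl , inj₁ refl

Covered : Fin n → List (Edge n) → Set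
Covered v M = Any (Incident v) M

Covered⇒Meets : Covered v M → Incident v e → ∃[ f ] f ∈ M × Meets e f
Covered⇒Meets covered ve with find covered
... | f , f∈M , vf = f , f∈M , (_ , ve , vf)

Joins : Fin n → Fin n → Edge n → Set
Joins p q e = e ≡ (p , q) ⊎ e ≡ (q , p)

Joins? : (p q : Fin n) → Decidable (Joins p q)
Joins? p q e = (e ≟ₑ (p , q)) ⊎-dec (e ≟ₑ (q , p))

Joins⇒Incidentˡ : Joins p q e → Incident p e
Joins⇒Incidentˡ (inj₁ refl) = inj₁ refl
Joins⇒Incidentˡ (inj₂ refl) = inj₂ refl

Joins⇒Incidentʳ : Joins p q e → Incident q e
Joins⇒Incidentʳ (inj₁ refl) = inj₂ refl
Joins⇒Incidentʳ (inj₂ refl) = inj₁ refl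

Incident-Joins : Joins p q e → Incident v e → v ≡ p ⊎ v ≡ q
Incident-Joins (inj₁ refl) (inj₁ refl) = inj₁ refl
Incident-Joins (inj₁ refl) (inj₂ refl) = inj₂ refl
Incident-Joins (inj₂ refl) (inj₁ refl) = inj₂ refl
Incident-Joins (inj₂ refl) (inj₂ refl) = inj₁ refl

≡⇒== : {u v : Fin n} → u ≡ v → T (u == v)
≡⇒== {u = u} {v} = fromWitness {a? = u ≟ v}

==⇒≡ : {u v : Fin n} → T (u == v) → u ≡ v
==⇒≡ {u = u} {v} = toWitness {a? = u ≟ v}

eqE⇒≡ : T (eqE e f) → e ≡ f
eqE⇒≡ {e = a , b} {c , d} t with Equivalence.to T-∧ t
... | a≡c , b≡d = cong₂ _,_ (==⇒≡ a≡c) (==⇒≡ b≡d)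

≡⇒eqE : e ≡ f → T (eqE e f)
≡⇒eqE {e = a , b} refl = T-∧-intro {a == a} (≡⇒== refl) (≡⇒== refl)

memE⇒∈ : T (memE e M) → e ∈ M
memE⇒∈ {M = M} t = Any.map eqE⇒≡ (T-any⇒Any _ M t)

∈⇒memE : e ∈ M → T (memE e M)
∈⇒memE e∈M = Any⇒T-any _ (Any.map ≡⇒eqE e∈M)

subE⇒⊆ : T (subE M N) → M ⊆ N
subE⇒⊆ {M = M} t e∈M = memE⇒∈ (lookup (T-all⇒All _ M t) e∈M)

⊆⇒subE : M ⊆ N → T (subE M N)
⊆⇒subE M⊆N = All⇒T-all _ (tabulate (λ e∈M → ∈⇒memE (M⊆N e∈M)))

meet⇒Meets : T (meet e f) → Meets e f
meet⇒Meets {e = a , b} {c , d} t with a ≟ c | a ≟ d | b ≟ c | b ≟ d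
... | yes refl | _ | _ | _ = a , inj₁ refl , inj₁ refl
... | no _ | yes refl | _ | _ = a , inj₁ refl , inj₂ refl
... | no _ | no _ | yes refl | _ = b , inj₂ refl , inj₁ refl
... | no _ | no _ | no _ | yes refl = b , inj₂ refl , inj₂ refl
meet⇒Meets {e = a , b} {c , d} () | no _ | no _ | no _ | no _

Meets⇒meet : Meets e f → T (meet e f)
Meets⇒meet {e = a , b} {c , d} m with a ≟ c | a ≟ d | b ≟ c | b ≟ d
... | yes _ | _ | _ | _ = _
... | no _ | yes _ | _ | _ = _
... | no _ | no _ | yes _ | _ = _
... | no _ | no _ | no _ | yes _ = _
... | no a≢c | no a≢d | no b≢c | no b≢d with m
...   | _ , inj₁ refl , inj₁ refl = a≢c refl
...   | _ , inj₁ refl , inj₂ refl = a≢d refl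
...   | _ , inj₂ refl , inj₁ refl = b≢c refl
...   | _ , inj₂ refl , inj₂ refl = b≢d refl

Meets? : (e f : Edge n) → Dec (Meets e f)
Meets? e f = map′ meet⇒Meets Meets⇒meet (T? (meet e f))

isPair⇒Joins : ∀ {p q a b : Fin n} → T (isPair p q a b) → Joins p q (a , b)
isPair⇒Joins {p = p} {q} {a} {b} t with Equivalence.to (T-∨ {(a == p) ∧ (b == q)}) t
... | inj₁ ab=pq with Equivalence.to T-∧ ab=pq
...   | a=p , b=q = inj₁ (cong₂ _,_ (==⇒≡ a=p) (==⇒≡ b=q))
isPair⇒Joins t | inj₂ ab=qp with Equivalence.to T-∧ ab=qp
...   | a=q , b=p = inj₂ (cong₂ _,_ (==⇒≡ a=q) (==⇒≡ b=p))

Joins⇒isPair : ∀ {p q a b : Fin n} → Joins p q (a , b) → isPair p q a b ≡ true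
Joins⇒isPair {p = p} {q} (inj₁ refl) =
  Equivalence.to T-≡ (T-∨-introˡ (T-∧-intro {p == p} (≡⇒== refl) (≡⇒== refl)))
Joins⇒isPair {p = p} {q} (inj₂ refl) =
  Equivalence.to T-≡ (T-∨-introʳ {(q == p) ∧ (p == q)} (T-∧-intro {q == q} (≡⇒== refl) (≡⇒== refl)))

¬Joins⇒isPair : ∀ {p q a b : Fin n} → ¬ Joins p q (a , b) → isPair p q a b ≡ false
¬Joins⇒isPair {p = p} {q} {a} {b} ¬j with isPair p q a b in eq
... | false = refl
... | true = ⊥-elim (¬j (isPair⇒Joins (Equivalence.from T-≡ eq)))

private
  row : Graph n → Fin n → List (Edge n)
  row {n} G i = map (i ,_) (filter (λ j → ((toℕ i <ᵇ toℕ j) ∧ adj G i j) Bool.≟ true) (allFin n))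

∈-edges⁻ : ∀ {n} (G : Graph n) {p q : Fin n} → (p , q) ∈ edges G → toℕ p < toℕ q × Adj G p q
∈-edges⁻ {n} G pq∈ with find (∈-concatMap⁻ (row G) {xs = allFin n} pq∈)
... | i , _ , pq∈row with ∈-map⁻ (i ,_) pq∈row
... | j , j∈ , refl
  with Equivalence.to T-∧ (Equivalence.from T-≡ (proj₂ (∈-filter⁻ _ {xs = allFin n} j∈)))
... | i<j , ij = <ᵇ⇒< _ _ i<j , Equivalence.to T-≡ ij

∈-edges⁺ : ∀ {n} (G : Graph n) {p q : Fin n} → toℕ p < toℕ q → Adj G p q → (p , q) ∈ edges G
∈-edges⁺ {n} G {p} {q} p<q pq =
  ∈-concatMap⁺ (row G) {xs = allFin n} (lose (∈-allFin p)
    (∈-map⁺ (p ,_) (∈-filter⁺ _ (∈-allFin q)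
      (Equivalence.to T-≡ (T-∧-intro {toℕ p <ᵇ toℕ q} (<⇒<ᵇ p<q) (Equivalence.from T-≡ pq))))))

edges-unique : ∀ {n} (G : Graph n) → Unique (edges G)
edges-unique {n} G = rows-unique (allFin n) (Unique.allFin⁺ n)
  where
  rows-unique : ∀ is → Unique is → Unique (concatMap (row G) is)
  rows-unique [] _ = []
  rows-unique (i ∷ is) (i∉is ∷ is!) =
    Unique.++⁺ (Unique.map⁺ (cong proj₂) (Unique.filter⁺ _ (Unique.allFin⁺ n)))
      (rows-unique is is!) disjoint
    where
    disjoint : ∀ {e} → e ∈ row G i × e ∈ concatMap (row G) is → ⊥
    disjoint (e∈row , e∈rows)
      with ∈-map⁻ (i ,_) e∈row | find (∈-concatMap⁻ (row G) {xs = is} e∈rows)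
    ... | _ , _ , refl | i′ , i∈is , e∈row′ with ∈-map⁻ (i′ ,_) e∈row′
    ...   | _ , _ , refl = All¬⇒¬Any i∉is i∈is

Adj⇒≢ : Adj G u v → u ≢ v
Adj⇒≢ {G = G} {u} uu refl with trans (sym uu) (irrefl G u)
... | ()

edges-Joins-unique : e ∈ edges G → f ∈ edges G → Joins p q e → Joins p q f → e ≡ f
edges-Joins-unique _ _ (inj₁ refl) (inj₁ refl) = refl
edges-Joins-unique _ _ (inj₂ refl) (inj₂ refl) = refl
edges-Joins-unique {G = G} e∈ f∈ (inj₁ refl) (inj₂ refl) =
  ⊥-elim (<-asym (proj₁ (∈-edges⁻ G e∈)) (proj₁ (∈-edges⁻ G f∈)))
edges-Joins-unique {G = G} e∈ f∈ (inj₂ refl) (inj₁ refl) =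
  ⊥-elim (<-asym (proj₁ (∈-edges⁻ G e∈)) (proj₁ (∈-edges⁻ G f∈)))

edge-joining : Adj G p q → ∃[ e ] e ∈ edges G × Joins p q e
edge-joining {G = G} {p} {q} pq with <-cmp (toℕ p) (toℕ q)
... | tri< p<q _ _ = (p , q) , ∈-edges⁺ G p<q pq , inj₁ refl
... | tri≈ _ p≡q _ = ⊥-elim (Adj⇒≢ {G = G} pq (toℕ-injective p≡q))
... | tri> _ _ q<p = (q , p) , ∈-edges⁺ G q<p (trans (Graph.sym G q p) pq) , inj₂ refl

-- Maximal matchings

Matching : List (Edge n) → Set
Matching M = ∀ {e f} → e ∈ M → f ∈ M → Meets e f → e ≡ f

Dominating : Graph n → List (Edge n) → Set
Dominating G M = ∀ {e} → e ∈ edges G → ∃[ f ] f ∈ M × Meets e f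

record IsMaximalMatching (G : Graph n) (M : List (Edge n)) : Set where
  field
    ⊆edges : M ⊆ edges G
    matching : Matching M
    dominating : Dominating G M

isMatching⇒Matching : T (isMatching M) → Matching M
isMatching⇒Matching {M = M} t e∈M f∈M e⋈f
  with Equivalence.to T-∨ (lookup (T-all⇒All _ M (lookup (T-all⇒All _ M t) e∈M)) f∈M)
... | inj₁ e=f = eqE⇒≡ e=f
... | inj₂ e∤f = ⊥-elim (T-not⇒¬T e∤f (Meets⇒meet e⋈f))

Matching⇒isMatching : Matching M → T (isMatching M)
Matching⇒isMatching {M = M} match =
  All⇒T-all _ (tabulate λ e∈M → All⇒T-all _ (tabulate λ f∈M → equal-or-apart e∈M f∈M))
  where
  equal-or-apart : e ∈ M → f ∈ M → T (eqE e f ∨ not (meet e f))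
  equal-or-apart {e} {f} e∈M f∈M with Meets? e f
  ... | yes e⋈f = T-∨-introˡ (≡⇒eqE (match e∈M f∈M e⋈f))
  ... | no e⋈̸f = T-∨-introʳ {eqE e f} (¬T⇒T-not (λ m → e⋈̸f (meet⇒Meets m)))

properMatchingExtension : List (Edge n) → List (Edge n) → Bool
properMatchingExtension M M′ = isMatching M′ ∧ subE M M′ ∧ not (subE M′ M)

extend-matching : ∀ {n} {G : Graph n} {M : List (Edge n)} {e : Edge n}
  → M ⊆ edges G → Matching M → e ∈ edges G → ¬ Any (Meets e) M
  → ∃[ M′ ] M′ ∈ subsets (edges G) × T (properMatchingExtension M M′)
extend-matching {n} {G} {M} {e} M⊆E match e∈E e⋈̸M =
  M′ , filter-∈-subsets Add? (edges G) , proper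
  where
  Add? : Decidable (λ d → d ∈ M ⊎ d ≡ e)
  Add? d = any? (d ≟ₑ_) M ⊎-dec (d ≟ₑ e)
  M′ : List (Edge n)
  M′ = filter Add? (edges G)
  e∉M : e ∉ M
  e∉M e∈M = e⋈̸M (lose e∈M (Meets-refl e))
  M′-match : Matching M′
  M′-match d∈ d′∈ d⋈d′
    with proj₂ (∈-filter⁻ Add? {xs = edges G} d∈) | proj₂ (∈-filter⁻ Add? {xs = edges G} d′∈)
  ... | inj₁ d∈M | inj₁ d′∈M = match d∈M d′∈M d⋈d′
  ... | inj₁ d∈M | inj₂ refl = ⊥-elim (e⋈̸M (lose d∈M (Meets-sym d⋈d′)))
  ... | inj₂ refl | inj₁ d′∈M = ⊥-elim (e⋈̸M (lose d′∈M d⋈d′))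
  ... | inj₂ refl | inj₂ refl = refl
  e∈M′ : e ∈ M′
  e∈M′ = ∈-filter⁺ Add? e∈E (inj₂ refl)
  proper : T (properMatchingExtension M M′)
  proper = T-∧-intro {isMatching M′} (Matching⇒isMatching M′-match)
             (T-∧-intro {subE M M′}
                (⊆⇒subE (λ d∈M → ∈-filter⁺ Add? (M⊆E d∈M) (inj₁ d∈M)))
                (¬T⇒T-not (λ M′⊆M → e∉M (subE⇒⊆ M′⊆M e∈M′))))

isMaximalMatching-sound : M ∈ subsets (edges G) → T (isMaximalMatching G M) → IsMaximalMatching G M
isMaximalMatching-sound {M = M} {G = G} M∈ t with Equivalence.to (T-∧ {isMatching M}) t
... | M-match , no-extension = record { ⊆edges = M⊆E ; matching = match ; dominating = dominate }
  where
  M⊆E : M ⊆ edges G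
  M⊆E = subsets-⊆ (edges G) M∈
  match : Matching M
  match = isMatching⇒Matching M-match
  dominate : Dominating G M
  dominate {e} e∈E with any? (Meets? e) M
  ... | yes e⋈M = find e⋈M
  ... | no e⋈̸M with extend-matching {G = G} M⊆E match e∈E e⋈̸M
  ...   | M′ , M′∈ , proper = ⊥-elim (T-not⇒¬T (lookup (T-all⇒All _ _ no-extension) M′∈) proper)

isMaximalMatching-complete : IsMaximalMatching G M → T (isMaximalMatching G M)
isMaximalMatching-complete {G = G} {M = M} maximal =
  T-∧-intro {isMatching M} (Matching⇒isMatching matching)
    (All⇒T-all _ (tabulate (λ M′∈ → ¬T⇒T-not (no-extension M′∈))))
  where
  open IsMaximalMatching maximal
  no-extension : ∀ {M′} → M′ ∈ subsets (edges G) → ¬ T (properMatchingExtension M M′)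
  no-extension {M′} M′∈ t with Equivalence.to T-∧ t
  ... | M′-match , rest with Equivalence.to (T-∧ {subE M M′}) rest
  ...   | M⊆M′ , M′⊈M = T-not⇒¬T M′⊈M (⊆⇒subE M′⊆M)
    where
    M′⊆M : M′ ⊆ M
    M′⊆M d∈M′ with dominating (subsets-⊆ (edges G) M′∈ d∈M′)
    ... | f , f∈M , d⋈f =
      subst (_∈ M) (sym (isMatching⇒Matching M′-match d∈M′ (subE⇒⊆ M⊆M′ f∈M) d⋈f)) f∈M

maximalMatchings : Graph n → List (List (Edge n))
maximalMatchings G = filter (λ M → isMaximalMatching G M Bool.≟ true) (subsets (edges G))

∈-maximalMatchings⁻ : M ∈ maximalMatchings G → M ∈ subsets (edges G) × IsMaximalMatching G M
∈-maximalMatchings⁻ {G = G} M∈ with ∈-filter⁻ _ {xs = subsets (edges G)} M∈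
... | M∈′ , maximal = M∈′ , isMaximalMatching-sound M∈′ (Equivalence.from T-≡ maximal)

∈-maximalMatchings⁺ : M ∈ subsets (edges G) → IsMaximalMatching G M → M ∈ maximalMatchings G
∈-maximalMatchings⁺ M∈ maximal =
  ∈-filter⁺ _ M∈ (Equivalence.to T-≡ (isMaximalMatching-complete maximal))

Ψ-≤-injection : ∀ {n} {G G′ : Graph n} (φ : List (Edge n) → List (Edge n))
  → (∀ {M} → M ∈ maximalMatchings G → φ M ∈ maximalMatchings G′)
  → (∀ {M N} → M ∈ maximalMatchings G → N ∈ maximalMatchings G → φ M ≡ φ N → M ≡ N)
  → Ψ G ≤ Ψ G′
Ψ-≤-injection {G = G} φ =
  length-≤-injection φ (Unique.filter⁺ _ (subsets-unique (edges-unique G)))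

-- Neighbourhoods of vertices of small degree

neighbours-complete : ∀ {n} (G : Graph n) {v u : Fin n} {ws}
  → Unique ws → All (Adj G v) ws → deg G v ≤ length ws → Adj G v u → u ∈ ws
neighbours-complete {n} G {v} {u} {ws} ws! ws-adj deg≤ vu with any? (u ≟_) ws
... | yes u∈ws = u∈ws
... | no u∉ws = ⊥-elim (<-irrefl refl (≤-trans u∷ws≤deg deg≤))
  where
  neighbour : ∀ {w} → w ∈ u ∷ ws → w ∈ filter (λ w → adj G v w Bool.≟ true) (allFin n)
  neighbour (here refl) = ∈-filter⁺ _ (∈-allFin u) vu
  neighbour (there w∈ws) = ∈-filter⁺ _ (∈-allFin _) (lookup ws-adj w∈ws)
  u∷ws≤deg : length (u ∷ ws) ≤ deg G v
  u∷ws≤deg = length-≤-injection (λ w → w) (¬Any⇒All¬ ws u∉ws ∷ ws!) neighbour (λ _ _ eq → eq)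

leaf-neighbour : ∀ {n} (G : Graph n) {v u w : Fin n} → Leaf G v → Adj G v w → Adj G v u → u ≡ w
leaf-neighbour G leaf vw vu with neighbours-complete G ([] ∷ []) (vw ∷ []) (≤-reflexive leaf) vu
... | here u≡w = u≡w

degree-two-neighbours : ∀ {n} (G : Graph n) {v u w y : Fin n}
  → deg G v ≡ 2 → w ≢ y → Adj G v w → Adj G v y → Adj G v u → u ≡ w ⊎ u ≡ y
degree-two-neighbours G deg≡2 w≢y vw vy vu
  with neighbours-complete G ((w≢y ∷ []) ∷ [] ∷ []) (vw ∷ vy ∷ []) (≤-reflexive deg≡2) vu
... | here u≡w = inj₁ u≡w
... | there (here u≡y) = inj₂ u≡y

-- Moving the leaf v₁ from v₂ to x

module _ {G : Graph n} {v₁ v₂ x a b : Fin n} where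

  moveAdj-removed : Joins v₁ v₂ (a , b) → moveAdj G v₁ v₂ x a b ≡ false
  moveAdj-removed j rewrite Joins⇒isPair j = refl

  moveAdj-added : ¬ Joins v₁ v₂ (a , b) → Joins v₁ x (a , b) → moveAdj G v₁ v₂ x a b ≡ true
  moveAdj-added ¬j j rewrite ¬Joins⇒isPair ¬j | Joins⇒isPair j = refl

  moveAdj-kept : ¬ Joins v₁ v₂ (a , b) → ¬ Joins v₁ x (a , b) → moveAdj G v₁ v₂ x a b ≡ adj G a b
  moveAdj-kept ¬j ¬j′ rewrite ¬Joins⇒isPair ¬j | ¬Joins⇒isPair ¬j′ = refl

module Shift {n} {G G′ : Graph n} {v₁ v₂ x : Fin n}
  (v₁≢x : v₁ ≢ x) (v₁v₂ : Adj G v₁ v₂) (v₂x : Adj G v₂ x)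
  (leaf : ∀ {u} → Adj G v₁ u → u ≡ v₂)
  (fork : ∀ {u} → Adj G v₂ u → u ≡ v₁ ⊎ u ≡ x)
  (G′-adj : ∀ u v → adj G′ u v ≡ moveAdj G v₁ v₂ x u v)
  where

  private
    E E′ : List (Edge n)
    E = edges G
    E′ = edges G′

  at-v₁ : e ∈ E → Incident v₁ e → Joins v₁ v₂ e
  at-v₁ {e = a , b} e∈ (inj₁ refl) = inj₁ (cong (v₁ ,_) (leaf (proj₂ (∈-edges⁻ G e∈))))
  at-v₁ {e = a , b} e∈ (inj₂ refl) =
    inj₂ (cong (_, v₁) (leaf (trans (Graph.sym G v₁ a) (proj₂ (∈-edges⁻ G e∈)))))

  at-v₂ : e ∈ E → Incident v₂ e → Joins v₁ v₂ e ⊎ Joins v₂ x e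
  at-v₂ {e = a , b} e∈ (inj₁ refl) with fork (proj₂ (∈-edges⁻ G e∈))
  ... | inj₁ refl = inj₁ (inj₂ refl)
  ... | inj₂ refl = inj₂ (inj₁ refl)
  at-v₂ {e = a , b} e∈ (inj₂ refl) with fork (trans (Graph.sym G v₂ a) (proj₂ (∈-edges⁻ G e∈)))
  ... | inj₁ refl = inj₁ (inj₁ refl)
  ... | inj₂ refl = inj₂ (inj₂ refl)

  x∉v₁v₂ : Joins v₁ v₂ e → ¬ Incident x e
  x∉v₁v₂ j xe with Incident-Joins j xe
  ... | inj₁ x≡v₁ = v₁≢x (sym x≡v₁)
  ... | inj₂ x≡v₂ = Adj⇒≢ {G = G} v₂x (sym x≡v₂)

  v₁x∉E : e ∈ E → ¬ Joins v₁ x e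
  v₁x∉E e∈ j = x∉v₁v₂ (at-v₁ e∈ (Joins⇒Incidentˡ j)) (Joins⇒Incidentʳ j)

  ∈-E′⁺ : e ∈ E → ¬ Joins v₁ v₂ e → e ∈ E′
  ∈-E′⁺ {e = a , b} e∈ ¬j with ∈-edges⁻ G e∈
  ... | a<b , ab =
    ∈-edges⁺ G′ a<b (trans (G′-adj a b) (trans (moveAdj-kept {G = G} ¬j (v₁x∉E e∈)) ab))

  ∈-E′⁻ : e ∈ E′ → Joins v₁ x e ⊎ (e ∈ E × ¬ Joins v₁ v₂ e)
  ∈-E′⁻ {e = a , b} e∈′ with ∈-edges⁻ G′ e∈′ | Joins? v₁ v₂ (a , b) | Joins? v₁ x (a , b)
  ... | _ , ab′ | yes j | _ with trans (sym ab′) (trans (G′-adj a b) (moveAdj-removed {G = G} j))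
  ...   | ()
  ∈-E′⁻ {e = a , b} e∈′ | _ , _ | no _ | yes j′ = inj₁ j′
  ∈-E′⁻ {e = a , b} e∈′ | a<b , ab′ | no ¬j | no ¬j′ =
    inj₂ (∈-edges⁺ G a<b (trans (sym (moveAdj-kept {G = G} ¬j ¬j′)) (trans (sym (G′-adj a b)) ab′))
         , ¬j)

  v₁x-edge : ∃[ e ] e ∈ E′ × Joins v₁ x e
  v₁x-edge = edge-joining {G = G′} (trans (G′-adj v₁ x) (moveAdj-added {G = G} ¬j₁₂ (inj₁ refl)))
    where
    ¬j₁₂ : ¬ Joins v₁ v₂ (v₁ , x)
    ¬j₁₂ (inj₁ eq) = Adj⇒≢ {G = G} v₂x (sym (cong proj₂ eq))
    ¬j₁₂ (inj₂ eq) = Adj⇒≢ {G = G} v₁v₂ (cong proj₁ eq)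

  Kept : List (Edge n) → Edge n → Set
  Kept M e = (Joins v₁ x e × ¬ Covered x M) ⊎ e ∈ M

  Kept? : (M : List (Edge n)) → Decidable (Kept M)
  Kept? M e = (Joins? v₁ x e ×-dec ¬? (any? (Incident? x) M)) ⊎-dec any? (e ≟ₑ_) M

  -- M − v₁v₂, plus v₁x when x is unmatched; written as a filter of E′ so that it lies in
  -- subsets E′, the list Ψ counts in.
  shift : List (Edge n) → List (Edge n)
  shift M = filter (Kept? M) E′

  module _ {M : List (Edge n)} (M⊆E : M ⊆ E) where

    ∈-shift⁻ : e ∈ shift M → (Joins v₁ x e × ¬ Covered x M) ⊎ (e ∈ M × ¬ Joins v₁ v₂ e)
    ∈-shift⁻ e∈ with ∈-filter⁻ (Kept? M) {xs = E′} e∈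
    ... | _ , inj₁ new = inj₁ new
    ... | e∈′ , inj₂ e∈M with ∈-E′⁻ e∈′
    ...   | inj₁ j = ⊥-elim (v₁x∉E (M⊆E e∈M) j)
    ...   | inj₂ (_ , ¬j) = inj₂ (e∈M , ¬j)

    ∈-shift⁺ : e ∈ M → ¬ Joins v₁ v₂ e → e ∈ shift M
    ∈-shift⁺ e∈M ¬j = ∈-filter⁺ (Kept? M) (∈-E′⁺ (M⊆E e∈M) ¬j) (inj₂ e∈M)

    x-covered-by-shift : Covered x (shift M)
    x-covered-by-shift = from (any? (Incident? x) M)
      where
      from : Dec (Covered x M) → Covered x (shift M)
      from (yes covered) with find covered
      ... | f , f∈M , xf = lose (∈-shift⁺ f∈M (λ j → x∉v₁v₂ j xf)) xf
      from (no uncovered) with v₁x-edge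
      ... | e , e∈′ , j = lose (∈-filter⁺ (Kept? M) e∈′ (inj₁ (j , uncovered))) (Joins⇒Incidentʳ j)

    v₁x-isolated : Joins v₁ x e → ¬ Covered x M → f ∈ M → ¬ Joins v₁ v₂ f → ¬ Meets e f
    v₁x-isolated je uncovered f∈M ¬jf (v , ve , vf) with Incident-Joins je ve
    ... | inj₁ refl = ¬jf (at-v₁ (M⊆E f∈M) vf)
    ... | inj₂ refl = uncovered (lose f∈M vf)

    shift-matching : Matching M → Matching (shift M)
    shift-matching match e∈ f∈ e⋈f with ∈-shift⁻ e∈ | ∈-shift⁻ f∈
    ... | inj₁ (je , _) | inj₁ (jf , _) =
      edges-Joins-unique {G = G′} (proj₁ (∈-filter⁻ (Kept? M) {xs = E′} e∈))
        (proj₁ (∈-filter⁻ (Kept? M) {xs = E′} f∈)) je jf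
    ... | inj₁ (je , uncovered) | inj₂ (f∈M , ¬jf) = ⊥-elim (v₁x-isolated je uncovered f∈M ¬jf e⋈f)
    ... | inj₂ (e∈M , ¬je) | inj₁ (jf , uncovered) =
      ⊥-elim (v₁x-isolated jf uncovered e∈M ¬je (Meets-sym e⋈f))
    ... | inj₂ (e∈M , _) | inj₂ (f∈M , _) = match e∈M f∈M e⋈f

    shift-dominating : Dominating G M → Dominating G′ (shift M)
    shift-dominating dominate e∈′ with ∈-E′⁻ e∈′
    ... | inj₁ j = Covered⇒Meets x-covered-by-shift (Joins⇒Incidentʳ j)
    ... | inj₂ (e∈ , ¬je) with dominate e∈
    ...   | f , f∈M , e⋈f@(v , ve , vf) with Joins? v₁ v₂ f
    ...     | no ¬jf = f , ∈-shift⁺ f∈M ¬jf , e⋈f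
    ...     | yes jf with Incident-Joins jf vf
    ...       | inj₁ refl = ⊥-elim (¬je (at-v₁ e∈ ve))
    ...       | inj₂ refl with at-v₂ e∈ ve
    ...         | inj₁ je = ⊥-elim (¬je je)
    ...         | inj₂ je = Covered⇒Meets x-covered-by-shift (Joins⇒Incidentʳ je)

  shift-maximal : M ∈ maximalMatchings G → shift M ∈ maximalMatchings G′
  shift-maximal {M = M} M∈ with ∈-maximalMatchings⁻ {G = G} M∈
  ... | _ , maximal = ∈-maximalMatchings⁺ {G = G′} (filter-∈-subsets (Kept? M) E′) record
    { ⊆edges = λ e∈ → proj₁ (∈-filter⁻ (Kept? M) {xs = E′} e∈)
    ; matching = shift-matching ⊆edges matching
    ; dominating = shift-dominating ⊆edges dominating
    }
    where open IsMaximalMatching maximal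

  module _ {M : List (Edge n)} (maximal : IsMaximalMatching G M) where
    open IsMaximalMatching maximal

    v₁v₂∈⇒v₂x∉ : Joins v₁ v₂ e → Joins v₂ x f → e ∈ M → f ∉ M
    v₁v₂∈⇒v₂x∉ je jf e∈M f∈M
      with matching e∈M f∈M (v₂ , Joins⇒Incidentʳ je , Joins⇒Incidentˡ jf)
    ... | refl = x∉v₁v₂ je (Joins⇒Incidentʳ jf)

    v₂x∉⇒v₁v₂∈ : e ∈ E → Joins v₁ v₂ e → f ∈ E → Joins v₂ x f → f ∉ M → e ∈ M
    v₂x∉⇒v₁v₂∈ {e = e} e∈ je f∈ jf f∉M with dominating e∈
    ... | d , d∈M , (v , ve , vd) = edge-at-v₁-or-v₂ (Incident-Joins je ve)
      where
      d∈E : d ∈ E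
      d∈E = ⊆edges d∈M
      d≡e : Joins v₁ v₂ d → d ≡ e
      d≡e jd = edges-Joins-unique {G = G} d∈E e∈ jd je
      edge-at-v₁-or-v₂ : v ≡ v₁ ⊎ v ≡ v₂ → e ∈ M
      edge-at-v₁-or-v₂ (inj₁ refl) = subst (_∈ M) (d≡e (at-v₁ d∈E vd)) d∈M
      edge-at-v₁-or-v₂ (inj₂ refl) with at-v₂ d∈E vd
      ... | inj₁ jd = subst (_∈ M) (d≡e jd) d∈M
      ... | inj₂ jd = ⊥-elim (f∉M (subst (_∈ M) (edges-Joins-unique {G = G} d∈E f∈ jd jf) d∈M))

  open IsMaximalMatching using (⊆edges)

  shift-reflects-∈ : IsMaximalMatching G M → IsMaximalMatching G N → shift M ≡ shift N
    → e ∈ M → ¬ Joins v₁ v₂ e → e ∈ N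
  shift-reflects-∈ M-max N-max shift-≡ e∈M ¬j
    with ∈-shift⁻ (⊆edges N-max) (subst (_ ∈_) shift-≡ (∈-shift⁺ (⊆edges M-max) e∈M ¬j))
  ... | inj₁ (j , _) = ⊥-elim (v₁x∉E (⊆edges M-max e∈M) j)
  ... | inj₂ (e∈N , _) = e∈N

  shift-⊆ : IsMaximalMatching G M → IsMaximalMatching G N → shift M ≡ shift N → M ⊆ N
  shift-⊆ M-max N-max shift-≡ {e} e∈M with Joins? v₁ v₂ e | edge-joining {G = G} v₂x
  ... | no ¬j | _ = shift-reflects-∈ M-max N-max shift-≡ e∈M ¬j
  ... | yes j | f , f∈ , jf = v₂x∉⇒v₁v₂∈ N-max (⊆edges M-max e∈M) j f∈ jf λ f∈N →
    v₁v₂∈⇒v₂x∉ M-max j jf e∈M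
      (shift-reflects-∈ N-max M-max (sym shift-≡) f∈N λ j′ → x∉v₁v₂ j′ (Joins⇒Incidentʳ jf))

  shift-injective : M ∈ maximalMatchings G → N ∈ maximalMatchings G → shift M ≡ shift N → M ≡ N
  shift-injective M∈ N∈ shift-≡ with ∈-maximalMatchings⁻ {G = G} M∈ | ∈-maximalMatchings⁻ {G = G} N∈
  ... | M∈E , M-max | N∈E , N-max =
    subsets-≡ (edges-unique G) M∈E N∈E
      (shift-⊆ M-max N-max shift-≡) (shift-⊆ N-max M-max (sym shift-≡))

lemma2p6 : ∀ {n : ℕ} (T : Graph n) (v₁ v₂ x : Fin n)
    → IsTree T
    → v₁ ≢ v₂ → v₂ ≢ x → v₁ ≢ x
    → Adj T v₁ v₂ → Adj T v₂ x
    → deg T v₂ ≡ 2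
    → Leaf T v₁
    → (T' : Graph n) → (∀ u v → adj T' u v ≡ moveAdj T v₁ v₂ x u v)
    → Ψ T' ≥ Ψ T
lemma2p6 T v₁ v₂ x _ _ _ v₁≢x v₁v₂ v₂x deg-v₂ leaf-v₁ T′ T′-adj =
  Ψ-≤-injection {G = T} {G′ = T′} shift shift-maximal shift-injective
  where
  open Shift {G = T} {G′ = T′} v₁≢x v₁v₂ v₂x
    (leaf-neighbour T leaf-v₁ v₁v₂)
    (degree-two-neighbours T deg-v₂ v₁≢x (trans (Graph.sym T v₂ v₁) v₁v₂) v₂x)
    T′-adj
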